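{- Let $M$ be an oriented regular matroid on ground set $E$. If $C$ is a circuit of $M$ and $K$ is a dijoin of $M$ with $C\subseteq K$, then $K$ is not minimal with respect to inclusion among dijoins.
   Context: $M$ is represented by a totally unimodular matrix $A$ with columns $\mathbf a_i$, $i\in E$. A circuit is a minimal linearly dependent set of columns; its relation has coefficients in $\{\pm1\}$, giving $C=C^+\sqcup C^-$. A cocircuit is a set $C^*\subseteq E$ minimal such that some linear functional $h$ has $h(\mathbf a_k)=0$ for $k\notin C^*$ and $h(\mathbf a_k)\ne0$ for $k\in C^*$ (values may be taken in $\{0,\pm1\}$); it is directed if $h$ can be chosen with $h(\mathbf a_k)=1$ for all $k\in C^*$. A dijoin is a subset of $E$ meeting every directed cocircuit. -}

module Defs where

open import Data.Nat using (ℕ; zero; suc)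
open import Data.Fin using (Fin; zero; suc; punchIn)
open import Data.Fin.Subset using (Subset; _∈_; _∉_; _⊆_; Nonempty)
open import Data.Rational using (ℚ; 0ℚ; 1ℚ; _+_; _*_; -_)
open import Data.Product using (Σ; ∃; _×_)
open import Data.Sum using (_⊎_)
open import Relation.Binary.PropositionalEquality using (_≡_; _≢_)
open import Relation.Nullary using (¬_)
open import Function.Definitions using (Injective)

sumF : ∀ {k} → (Fin k → ℚ) → ℚ
sumF {zero}  f = 0ℚ
sumF {suc k} f = f zero + sumF (λ i → f (suc i))

sgnTerm : ∀ {k} → ℚ → Fin k → ℚ
sgnTerm x zero    = x
sgnTerm x (suc j) = - sgnTerm x j

det : ∀ {k} → (Fin k → Fin k → ℚ) → ℚ
det {zero}  B = 1ℚ
det {suc k} B =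
  sumF (λ j → sgnTerm (B zero j * det (λ r c → B (suc r) (punchIn j c))) j)

-- A matrix with m rows and n columns (ground set E = Fin n, column a_i = A · i).
Matrix : ℕ → ℕ → Set
Matrix m n = Fin m → Fin n → ℚ

TotallyUnimodular : ∀ {m n} → Matrix m n → Set
TotallyUnimodular {m} {n} A =
  ∀ k (r : Fin k → Fin m) (c : Fin k → Fin n) →
  Injective _≡_ _≡_ r → Injective _≡_ _≡_ c →
  let d = det (λ i j → A (r i) (c j)) in (d ≡ 0ℚ ⊎ d ≡ 1ℚ) ⊎ d ≡ - 1ℚ

Dependent : ∀ {m n} → Matrix m n → Subset n → Set
Dependent {m} {n} A S =
  Σ (Fin n → ℚ) λ coef →
    (∀ i → i ∉ S → coef i ≡ 0ℚ) ×
    (∃ λ i → coef i ≢ 0ℚ) ×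
    (∀ r → sumF (λ i → coef i * A r i) ≡ 0ℚ)

IsCircuit : ∀ {m n} → Matrix m n → Subset n → Set
IsCircuit {m} {n} A C =
  Dependent A C × (∀ D → D ⊆ C → Dependent A D → C ⊆ D)

apply : ∀ {m n} → Matrix m n → (Fin m → ℚ) → Fin n → ℚ
apply A y k = sumF (λ r → y r * A r k)

IsSupport : ∀ {m n} → Matrix m n → Subset n → Set
IsSupport {m} {n} A S =
  Σ (Fin m → ℚ) λ y →
    (∀ k → k ∉ S → apply A y k ≡ 0ℚ) × (∀ k → k ∈ S → apply A y k ≢ 0ℚ)

IsCocircuit : ∀ {m n} → Matrix m n → Subset n → Set
IsCocircuit {m} {n} A S =
  IsSupport A S × Nonempty S ×
  (∀ D → D ⊆ S → Nonempty D → IsSupport A D → S ⊆ D)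

IsDirectedCocircuit : ∀ {m n} → Matrix m n → Subset n → Set
IsDirectedCocircuit {m} {n} A S =
  IsCocircuit A S ×
  Σ (Fin m → ℚ) λ y →
    (∀ k → k ∉ S → apply A y k ≡ 0ℚ) × (∀ k → k ∈ S → apply A y k ≡ 1ℚ)

IsDijoin : ∀ {m n} → Matrix m n → Subset n → Set
IsDijoin {m} {n} A K =
  ∀ S → IsDirectedCocircuit A S → ∃ λ k → k ∈ S × k ∈ K

IsMinimalDijoin : ∀ {m n} → Matrix m n → Subset n → Set
IsMinimalDijoin {m} {n} A K =
  IsDijoin A K × (∀ K' → IsDijoin A K' → K' ⊆ K → K ⊆ K')

-- The coefficients of a linear relation among the columns are orthogonal to the values
-- h(a_i) of every linear functional h. If the functional of a directed cocircuit S met the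
-- support of the relation only in e, orthogonality would reduce to coef e · 1 = 0. So a
-- dijoin K containing a circuit stays a dijoin after deleting any element of the circuit.
module Submission where

open import Defs
open import Data.Nat using (zero; suc)
open import Data.Fin using (Fin; zero; suc)
open import Data.Vec.Functional using (removeAt)
open import Data.Fin.Properties using (any?; punchInᵢ≢i) renaming (_≟_ to _≟F_)
open import Data.Fin.Subset using (Subset; _⊆_; _∈_; _∉_; _-_)
open import Data.Fin.Subset.Properties
  using (_∈?_; p─q⊆p; x∈p∧x≢y⇒x∈p-y; x∈p⇒p-x⊂p; ⊂-irref; ⊂-⊆-trans)
open import Data.Rational using (ℚ; 0ℚ; 1ℚ; _+_; _*_)
open import Data.Rational.Properties
  using (+-*-commutativeRing; +-identityʳ; *-zeroˡ; *-zeroʳ; *-identityʳ)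
  renaming (_≟_ to _≟ℚ_)
open import Algebra.Bundles using (CommutativeRing)
open import Data.Product using (_,_)
open import Relation.Nullary using (¬_; yes; no; contradiction)
open import Relation.Nullary.Decidable using (_×-dec_)
open import Relation.Binary.PropositionalEquality

open CommutativeRing +-*-commutativeRing using (semiring; *-commutativeSemigroup)
open import Algebra.Properties.Semiring.Sum semiring
  using (sum; sum-cong-≗; sum-remove; sum-replicate-zero; ∑-comm; *-distribˡ-sum)
open import Algebra.Properties.CommutativeSemigroup *-commutativeSemigroup
  using (x∙yz≈y∙xz)

IsLinearRelation : ∀ {m n} → Matrix m n → (Fin n → ℚ) → Set
IsLinearRelation A coef = ∀ r → sumF (λ i → coef i * A r i) ≡ 0ℚ

sumF≡sum : ∀ {k} (f : Fin k → ℚ) → sumF f ≡ sum f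
sumF≡sum {zero}  f = refl
sumF≡sum {suc k} f = cong (f zero +_) (sumF≡sum (λ i → f (suc i)))

sumF-supported-at : ∀ {k} (f : Fin k → ℚ) e → (∀ i → i ≢ e → f i ≡ 0ℚ) → sumF f ≡ f e
sumF-supported-at {suc k} f e vanishes = begin
  sumF f                   ≡⟨ sumF≡sum f ⟩
  sum f                    ≡⟨ sum-remove {i = e} f ⟩
  f e + sum (removeAt f e) ≡⟨ cong (f e +_) rest-vanishes ⟩
  f e + 0ℚ                 ≡⟨ +-identityʳ (f e) ⟩
  f e                      ∎
  where
  open ≡-Reasoning
  rest-vanishes : sum (removeAt f e) ≡ 0ℚ
  rest-vanishes = trans (sum-cong-≗ (λ i → vanishes _ (punchInᵢ≢i e i))) (sum-replicate-zero k)

linearRelation-orthogonal : ∀ {m n} (A : Matrix m n) (coef : Fin n → ℚ) (y : Fin m → ℚ) →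
  IsLinearRelation A coef →
  sumF (λ i → coef i * apply A y i) ≡ 0ℚ
linearRelation-orthogonal {m} A coef y relation = begin
  sumF (λ i → coef i * apply A y i)
    ≡⟨ sumF≡sum (λ i → coef i * apply A y i) ⟩
  sum (λ i → coef i * apply A y i)
    ≡⟨ sum-cong-≗ (λ i → cong (coef i *_) (sumF≡sum (λ r → y r * A r i))) ⟩
  sum (λ i → coef i * sum (λ r → y r * A r i))
    ≡⟨ sum-cong-≗ (λ i → *-distribˡ-sum (coef i) (λ r → y r * A r i)) ⟩
  sum (λ i → sum (λ r → coef i * (y r * A r i)))
    ≡⟨ sum-cong-≗ (λ i → sum-cong-≗ (λ r → x∙yz≈y∙xz (coef i) (y r) (A r i))) ⟩
  sum (λ i → sum (λ r → y r * (coef i * A r i)))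
    ≡⟨ ∑-comm (λ i r → y r * (coef i * A r i)) ⟩
  sum (λ r → sum (λ i → y r * (coef i * A r i)))
    ≡⟨ sum-cong-≗ (λ r → sym (*-distribˡ-sum (y r) (λ i → coef i * A r i))) ⟩
  sum (λ r → y r * sum (λ i → coef i * A r i))
    ≡⟨ sum-cong-≗ row-vanishes ⟩
  sum (λ (_ : Fin m) → 0ℚ)
    ≡⟨ sum-replicate-zero m ⟩
  0ℚ ∎
  where
  open ≡-Reasoning
  row-vanishes : ∀ r → y r * sum (λ i → coef i * A r i) ≡ 0ℚ
  row-vanishes r = begin
    y r * sum (λ i → coef i * A r i)  ≡⟨ cong (y r *_) (sym (sumF≡sum (λ i → coef i * A r i))) ⟩
    y r * sumF (λ i → coef i * A r i) ≡⟨ cong (y r *_) (relation r) ⟩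
    y r * 0ℚ                          ≡⟨ *-zeroʳ (y r) ⟩
    0ℚ                                ∎

∈-of-nonzero : ∀ {n} {S : Subset n} (f : Fin n → ℚ) → (∀ i → i ∉ S → f i ≡ 0ℚ) →
  ∀ i → f i ≢ 0ℚ → i ∈ S
∈-of-nonzero {S = S} f vanishes-outside i fi≢0 with i ∈? S
... | yes i∈S = i∈S
... | no  i∉S = contradiction (vanishes-outside i i∉S) fi≢0

linearRelation-vanishes-at-sole-contact :
  ∀ {m n} (A : Matrix m n) (coef : Fin n → ℚ) (y : Fin m → ℚ) (S : Subset n) e →
  IsLinearRelation A coef →
  (∀ k → k ∉ S → apply A y k ≡ 0ℚ) → (∀ k → k ∈ S → apply A y k ≡ 1ℚ) →
  e ∈ S → (∀ i → i ≢ e → coef i ≢ 0ℚ → i ∉ S) → coef e ≡ 0ℚ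
linearRelation-vanishes-at-sole-contact A coef y S e relation zero-outside one-inside e∈S sole =
  begin
    coef e                            ≡⟨ sym (*-identityʳ (coef e)) ⟩
    coef e * 1ℚ                       ≡⟨ cong (coef e *_) (sym (one-inside e e∈S)) ⟩
    coef e * apply A y e              ≡⟨ sym (sumF-supported-at (λ i → coef i * apply A y i) e other-terms-vanish) ⟩
    sumF (λ i → coef i * apply A y i) ≡⟨ linearRelation-orthogonal A coef y relation ⟩
    0ℚ                                ∎
  where
  open ≡-Reasoning
  other-terms-vanish : ∀ i → i ≢ e → coef i * apply A y i ≡ 0ℚ
  other-terms-vanish i i≢e with coef i ≟ℚ 0ℚ
  ... | yes coef-i≡0 = trans (cong (_* apply A y i) coef-i≡0) (*-zeroˡ (apply A y i))
  ... | no  coef-i≢0 = trans (cong (coef i *_) (zero-outside i (sole i i≢e coef-i≢0))) (*-zeroʳ (coef i))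

dijoin-remove-linearRelation-element :
  ∀ {m n} (A : Matrix m n) (K : Subset n) (coef : Fin n → ℚ) e →
  IsLinearRelation A coef → (∀ i → coef i ≢ 0ℚ → i ∈ K) → coef e ≢ 0ℚ →
  IsDijoin A K → IsDijoin A (K - e)
dijoin-remove-linearRelation-element A K coef e relation support⊆K coef-e≢0 dijoin
  S directed@(_ , y , zero-outside , one-inside)
  with any? (λ k → (k ∈? S) ×-dec (k ∈? (K - e)))
... | yes meets = meets
... | no  disjoint =
  contradiction
    (linearRelation-vanishes-at-sole-contact A coef y S e relation zero-outside one-inside e∈S sole)
    coef-e≢0
  where
  e∈S : e ∈ S
  e∈S with dijoin S directed
  ... | k , k∈S , k∈K with k ≟F e
  ...   | yes refl = k∈S
  ...   | no  k≢e  = contradiction (k , k∈S , x∈p∧x≢y⇒x∈p-y k∈K k≢e) disjoint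
  sole : ∀ i → i ≢ e → coef i ≢ 0ℚ → i ∉ S
  sole i i≢e coef-i≢0 i∈S =
    disjoint (i , i∈S , x∈p∧x≢y⇒x∈p-y (support⊆K i coef-i≢0) i≢e)

lemma4p4 : ∀ {m n} (A : Matrix m n) → TotallyUnimodular A →
           (C K : Subset n) → IsCircuit A C → IsDijoin A K → C ⊆ K →
           ¬ IsMinimalDijoin A K
lemma4p4 A _ C K ((coef , zero-outside-C , (e , coef-e≢0) , relation) , _)
         dijoin C⊆K (_ , minimal) =
  ⊂-irref refl (⊂-⊆-trans (x∈p⇒p-x⊂p e∈K) (minimal (K - e) dijoin-without-e (p─q⊆p K _)))
  where
  support⊆K : ∀ i → coef i ≢ 0ℚ → i ∈ K
  support⊆K i coef-i≢0 = C⊆K (∈-of-nonzero coef zero-outside-C i coef-i≢0)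
  dijoin-without-e : IsDijoin A (K - e)
  dijoin-without-e =
    dijoin-remove-linearRelation-element A K coef e relation support⊆K coef-e≢0 dijoin
  e∈K : e ∈ K
  e∈K = support⊆K e coef-e≢0
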